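{- For every $n\ge1$, the matrix $B_n$ is block lower triangular with respect to the grouping of the subsets of $[n-1]$ according to their maximum: for $I,J\subseteq[n-1]$ with $\max(J)>\max(I)$, the $(I,J)$ entry of $B_n$ is $0$. Moreover, for each $k\in[n]$, the diagonal block $A_k$ of $B_n$ with rows and columns indexed by the subsets $I\subseteq[n-1]$ with $\max(I)=k-1$ (in the given order) does not depend on $n$; $A_k$ is $2^{k-2}\times2^{k-2}$ for $k\ge2$ and $1\times1$ for $k=1$.
   Context: Here $q$ is a parameter (real number or indeterminate) and $\max\emptyset:=0$. Define the square matrix $B_n$ with rows and columns indexed by the subsets of $[n-1]$, ordered as follows: $I$ comes before $J$ iff the word listing the elements of $I$ in decreasing order precedes the word for $J$ in lexicographic order (a proper prefix precedes; e.g. $\emptyset,\{1\},\{2\},\{2,1\},\{3\},\{3,1\},\{3,2\},\{3,2,1\}$). For $I\subseteq[n-1]$ let $\operatorname{Peak}(I)=I\setminus(I+1)\setminus\{1\}$ with $I+1=\{i+1:i\in I\}$. The $(I,J)$ entry of $B_n$ is $\sum(-q)^{|K|}(q-1)^{|J'|}$ over pairs $(J',K)$ with $J'\subseteq I$, $K\subseteq\operatorname{Peak}(I)$, $J'\cap K=\emptyset$ and $J'\cup(K-1)\cup K=J$, where $K-1=\{k-1:k\in K\}$. (This is the coefficient of $\eta^{(q)}_J$ in the expansion of the $q$-fundamental quasisymmetric function $L^{(q)}_I$ in the enriched $q$-monomial basis.) -}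

module Defs where

open import Level using (Level)
open import Data.Bool using (Bool; true; false; _∧_; _∨_; not; if_then_else_; T)
open import Data.Bool.Properties using (T?)
open import Data.Nat using (ℕ; zero; suc; _∸_; _⊔_; _≡ᵇ_)
import Data.Nat.Properties as ℕP
open import Data.List using (List; []; _∷_; _++_; map; filter; foldr; length; downFrom; lookup)
open import Data.Fin using (Fin)
open import Relation.Nullary.Decidable using (does)
open import Relation.Binary.PropositionalEquality using (_≡_)
open import Algebra.Bundles using (CommutativeRing)
import Data.List.Relation.Binary.Lex.NonStrict as LexNS
import Data.List.Sort.InsertionSort as InsSort

-- A subset of [n-1] is represented by the word listing its elements in
-- decreasing order (a strictly decreasing list of positive naturals).
Sub : Set
Sub = List ℕ

-- max, with max ∅ = 0
maxS : Sub → ℕ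
maxS = foldr _⊔_ 0

anyᵇ : (ℕ → Bool) → Sub → Bool
anyᵇ p = foldr (λ x b → p x ∨ b) false

allᵇ : (ℕ → Bool) → Sub → Bool
allᵇ p = foldr (λ x b → p x ∧ b) true

_∈ᵇ_ : ℕ → Sub → Bool
x ∈ᵇ I = anyᵇ (λ y → x ≡ᵇ y) I

-- all sub-words (subsets) of a word; order preserved, so decreasing words stay decreasing
powerset : Sub → List Sub
powerset []       = [] ∷ []
powerset (x ∷ xs) = map (x ∷_) (powerset xs) ++ powerset xs

-- lexicographic (non-strict) order on words, proper prefix precedes
lexOrder = LexNS.≤-decTotalOrder ℕP.≤-decTotalOrder

open InsSort lexOrder using (sort)

subsetsOf : ℕ → List Sub
subsetsOf n = sort (powerset (map suc (downFrom (n ∸ 1))))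

peak : Sub → Sub
peak I = filter (λ x → T? (not (x ≡ᵇ 1) ∧ not ((x ∸ 1) ∈ᵇ I))) I

minus1 : Sub → Sub
minus1 = map (_∸ 1)

sameSet : Sub → Sub → Bool
sameSet A B = allᵇ (λ x → x ∈ᵇ B) A ∧ allᵇ (λ x → x ∈ᵇ A) B

disjoint : Sub → Sub → Bool
disjoint A B = allᵇ (λ x → not (x ∈ᵇ B)) A

module _ {c ℓ : Level} (R : CommutativeRing c ℓ) where
  open CommutativeRing R

  pow : Carrier → ℕ → Carrier
  pow x zero    = 1#
  pow x (suc m) = x * pow x m

  sumR : List Carrier → Carrier
  sumR = foldr _+_ 0#

  entry : Carrier → Sub → Sub → Carrier
  entry q I J =
    sumR (map (λ J' → sumR (map (λ K →
        if disjoint J' K ∧ sameSet (J' ++ minus1 K ++ K) J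
        then pow (- q) (length K) * pow (q - 1#) (length J')
        else 0#)
      (powerset (peak I))))
      (powerset I))

  B : Carrier → (n : ℕ) → Fin (length (subsetsOf n)) → Fin (length (subsetsOf n)) → Carrier
  B q n i j = entry q (lookup (subsetsOf n) i) (lookup (subsetsOf n) j)

  blockIdx : ℕ → ℕ → List Sub
  blockIdx n k = filter (λ I → maxS I Data.Nat.≟ (k ∸ 1)) (subsetsOf n)

  blockA : Carrier → ℕ → ℕ → List (List Carrier)
  blockA q n k = map (λ I → map (entry q I) (blockIdx n k)) (blockIdx n k)

-- Every set J' ∪ (K-1) ∪ K indexed by a term of the (I,J) entry has maximum at most max I,
-- so it can equal J only if max J ≤ max I. For the diagonal blocks, filtering by max = k-1
-- commutes with sorting, and among the subsets of [m] with m ≥ k-1 those with maximum k-1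
-- are exactly the sets {k-1} ∪ S with S ⊆ [k-2], independently of m; there are 2^(k-2).
module Submission where

open import Defs
open import Level using (Level)
open import Data.Bool using (true; false; _∧_; if_then_else_; T)
open import Data.Bool.Properties using (T-∧; T-∨)
open import Data.Nat using (ℕ; zero; suc; _+_; _≤_; _<_; s≤s; _≤′_; ≤′-refl; ≤′-step; _∸_; _^_; _⊔_; _≟_; z≤n)
open import Data.Nat.Properties
  using (≤-refl; ≤-trans; ⊔-assoc; <⇒≱; n≤1+n; m≤m⊔n; m≤n⊔m; ⊔-lub; ⊔-mono-≤; ⊔-monoʳ-≤;
         m≥n⇒m⊔n≡m; m∸n≤m; ∸-monoˡ-≤; ≡ᵇ⇒≡; ≤⇒≤′; ≤′⇒≤; ≤-reflexive; +-identityʳ; ∸-+-assoc)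
open import Data.List using (List; []; _∷_; _++_; map; filter; length; lookup; downFrom)
open import Data.List.Properties using (length-map; length-++; length-downFrom; filter-++; filter-all; filter-none; ++-identityʳ)
open import Data.List.Relation.Unary.All as All using (All; []; _∷_)
import Data.List.Relation.Unary.All.Properties as All
import Data.List.Relation.Binary.Pointwise as Pointwise
open import Data.List.Relation.Binary.Permutation.Propositional using (↭-sym; ↭-trans; ↭⇒↭ₛ′)
open import Data.List.Relation.Binary.Permutation.Propositional.Properties using (filter-↭; ↭-length)
import Data.List.Relation.Unary.Sorted.TotalOrder.Properties as Sorted
import Data.List.Sort.InsertionSort.Base as InsertionSort
import Data.List.Sort.InsertionSort.Properties as InsertionSortₚ
open import Data.Fin using (Fin)
open import Data.Product using (_×_; _,_; proj₂)
open import Data.Sum using (inj₁; inj₂)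
open import Data.Empty using (⊥-elim)
open import Function using (Equivalence)
open import Relation.Nullary using (¬_; does)
open import Relation.Unary using (Pred; Decidable)
open import Relation.Binary.Bundles using (DecTotalOrder)
open import Relation.Binary.PropositionalEquality using (_≡_; refl; sym; trans; cong; cong₂; subst; module ≡-Reasoning)
open import Algebra.Bundles using (CommutativeRing)

open Equivalence using (to)

module _ {a ℓ₁ ℓ₂} (O : DecTotalOrder a ℓ₁ ℓ₂) where
  open DecTotalOrder O using (totalOrder; Carrier; module Eq)
  open InsertionSort O using (sort)
  open InsertionSortₚ O using (sort-↭; sort-↗)
  open import Data.List.Relation.Binary.Equality.Setoid Eq.setoid using (_≋_)

  -- Both sides are sorted permutations of  filter P? xs.
  filter-sort : ∀ {p} {P : Pred Carrier p} (P? : Decidable P) (xs : List Carrier) →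
                filter P? (sort xs) ≋ sort (filter P? xs)
  filter-sort P? xs = Sorted.↗↭↗⇒≋ totalOrder
    (Sorted.filter⁺ totalOrder P? (sort-↗ xs)) (sort-↗ (filter P? xs))
    (↭⇒↭ₛ′ Eq.isEquivalence (↭-trans (filter-↭ P? (sort-↭ xs)) (↭-sym (sort-↭ (filter P? xs)))))

open InsertionSort lexOrder using (sort)
open InsertionSortₚ lexOrder using (sort-↭)

-- The equivalence of lexOrder is Pointwise _≡_, so ≋ collapses to ≡.
filter-sort-lexOrder : ∀ {p} {P : Pred Sub p} (P? : Decidable P) (xs : List Sub) →
                 filter P? (sort xs) ≡ sort (filter P? xs)
filter-sort-lexOrder P? xs =
  Pointwise.Pointwise-≡⇒≡ (Pointwise.map Pointwise.Pointwise-≡⇒≡ (filter-sort lexOrder P? xs))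

maxS-++ : ∀ xs ys → maxS (xs ++ ys) ≡ maxS xs ⊔ maxS ys
maxS-++ []       ys = refl
maxS-++ (x ∷ xs) ys = trans (cong (x ⊔_) (maxS-++ xs ys)) (sym (⊔-assoc x (maxS xs) (maxS ys)))

maxS-minus1 : ∀ K → maxS (minus1 K) ≤ maxS K
maxS-minus1 []      = z≤n
maxS-minus1 (k ∷ K) = ⊔-mono-≤ (m∸n≤m k 1) (maxS-minus1 K)

maxS-filter : ∀ {p} {P : Pred ℕ p} (P? : Decidable P) xs → maxS (filter P? xs) ≤ maxS xs
maxS-filter P? []       = z≤n
maxS-filter P? (x ∷ xs) with does (P? x)
... | true  = ⊔-monoʳ-≤ x (maxS-filter P? xs)
... | false = ≤-trans (maxS-filter P? xs) (m≤n⊔m x (maxS xs))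

maxS-powerset : ∀ xs → All (λ ys → maxS ys ≤ maxS xs) (powerset xs)
maxS-powerset []       = z≤n ∷ []
maxS-powerset (x ∷ xs) = All.++⁺
  (All.map⁺ (All.map (⊔-monoʳ-≤ x) (maxS-powerset xs)))
  (All.map (λ h → ≤-trans h (m≤n⊔m x (maxS xs))) (maxS-powerset xs))

∈ᵇ⇒≤maxS : ∀ x A → T (x ∈ᵇ A) → x ≤ maxS A
∈ᵇ⇒≤maxS x (y ∷ A) x∈A with to T-∨ x∈A
... | inj₁ x≡y = subst (_≤ y ⊔ maxS A) (sym (≡ᵇ⇒≡ x y x≡y)) (m≤m⊔n y (maxS A))
... | inj₂ x∈A = ≤-trans (∈ᵇ⇒≤maxS x A x∈A) (m≤n⊔m y (maxS A))

⊆ᵇ⇒maxS≤ : ∀ A J → T (allᵇ (_∈ᵇ A) J) → maxS J ≤ maxS A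
⊆ᵇ⇒maxS≤ A []      _    = z≤n
⊆ᵇ⇒maxS≤ A (x ∷ J) J⊆A with to T-∧ J⊆A
... | x∈A , J⊆A = ⊔-lub (∈ᵇ⇒≤maxS x A x∈A) (⊆ᵇ⇒maxS≤ A J J⊆A)

sameSet⇒maxS≤ : ∀ A J → T (sameSet A J) → maxS J ≤ maxS A
sameSet⇒maxS≤ A J A≡J = ⊆ᵇ⇒maxS≤ A J (proj₂ (to (T-∧ {allᵇ (_∈ᵇ J) A}) A≡J))

maxS-cover≤ : ∀ {m} J' K → maxS J' ≤ m → maxS K ≤ m → maxS (J' ++ minus1 K ++ K) ≤ m
maxS-cover≤ {m} J' K J'≤m K≤m = subst (_≤ m) (sym maxS-cover) (⊔-lub J'≤m (⊔-lub (≤-trans (maxS-minus1 K) K≤m) K≤m))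
  where
  maxS-cover : maxS (J' ++ minus1 K ++ K) ≡ maxS J' ⊔ (maxS (minus1 K) ⊔ maxS K)
  maxS-cover = trans (maxS-++ J' (minus1 K ++ K)) (cong (maxS J' ⊔_) (maxS-++ (minus1 K) K))

module _ {c ℓ : Level} (R : CommutativeRing c ℓ) where
  open CommutativeRing R using (Carrier; _≈_; 0#; +-cong; +-identityˡ) renaming (refl to ≈-refl; trans to ≈-trans)

  sumR-≈0 : ∀ {A : Set} (f : A → Carrier) {xs} → All (λ x → f x ≈ 0#) xs → sumR R (map f xs) ≈ 0#
  sumR-≈0 f []             = ≈-refl
  sumR-≈0 f (fx≈0 ∷ fxs≈0) = ≈-trans (+-cong fx≈0 (sumR-≈0 f fxs≈0)) (+-identityˡ 0#)

  if-≈0 : ∀ {b} (t : Carrier) → ¬ T b → (if b then t else 0#) ≈ 0#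
  if-≈0 {true}  t ¬b = ⊥-elim (¬b _)
  if-≈0 {false} t _  = ≈-refl

  entry-vanishes : ∀ q I J → maxS I < maxS J → entry R q I J ≈ 0#
  entry-vanishes q I J I<J =
    sumR-≈0 _ (All.map (λ {J'} J'≤I → sumR-≈0 _ (All.map (λ {K} K≤peak → if-≈0 _ (guard-false J' K J'≤I K≤peak))
                                                 (maxS-powerset (peak I))))
                       (maxS-powerset I))
    where
    guard-false : ∀ J' K → maxS J' ≤ maxS I → maxS K ≤ maxS (peak I) →
                  ¬ T (disjoint J' K ∧ sameSet (J' ++ minus1 K ++ K) J)
    guard-false J' K J'≤I K≤peak guard =
      <⇒≱ I<J (≤-trans (sameSet⇒maxS≤ A J (proj₂ (to (T-∧ {disjoint J' K}) guard)))
                       (maxS-cover≤ J' K J'≤I (≤-trans K≤peak (maxS-filter _ I))))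
      where A = J' ++ minus1 K ++ K

-- elems m = [m, …, 1], so subsetsOf n unfolds to sort (powerset (elems (n ∸ 1))).
elems : ℕ → Sub
elems m = map suc (downFrom m)

hasMax : (j : ℕ) → Decidable (λ I → maxS I ≡ j)
hasMax j I = maxS I ≟ j

subsetsWithMax : ℕ → List Sub
subsetsWithMax j = filter (hasMax j) (powerset (elems j))

maxS-elems : ∀ m → maxS (elems m) ≤ m
maxS-elems zero    = z≤n
maxS-elems (suc m) = ⊔-lub ≤-refl (≤-trans (maxS-elems m) (n≤1+n m))

maxS-powerset-elems : ∀ m → All (λ ys → maxS ys ≤ m) (powerset (elems m))
maxS-powerset-elems m = All.map (λ h → ≤-trans h (maxS-elems m)) (maxS-powerset (elems m))

length-powerset : ∀ xs → length (powerset xs) ≡ 2 ^ length xs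
length-powerset []       = refl
length-powerset (x ∷ xs) = begin
  length (map (x ∷_) P ++ P)        ≡⟨ length-++ (map (x ∷_) P) ⟩
  length (map (x ∷_) P) + length P  ≡⟨ cong (_+ length P) (length-map (x ∷_) P) ⟩
  length P + length P               ≡⟨ cong (λ l → l + l) (length-powerset xs) ⟩
  2 ^ length xs + 2 ^ length xs     ≡⟨ cong (2 ^ length xs +_) (sym (+-identityʳ _)) ⟩
  2 ^ suc (length xs)               ∎
  where
  open ≡-Reasoning
  P = powerset xs

filter-hasMax-∷-none : ∀ {j x} → j < x → (Ys : List Sub) → filter (hasMax j) (map (x ∷_) Ys) ≡ []
filter-hasMax-∷-none {j} {x} j<x Ys =
  filter-none (hasMax j) (All.map⁺ (All.universal (λ ys max≡j → <⇒≱ j<x (subst (x ≤_) max≡j (m≤m⊔n x (maxS ys)))) Ys))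

filter-hasMax-powerset-elems : ∀ {j m} → j ≤′ m → filter (hasMax j) (powerset (elems m)) ≡ subsetsWithMax j
filter-hasMax-powerset-elems ≤′-refl = refl
filter-hasMax-powerset-elems {j} (≤′-step {m} j≤m) = begin
  filter (hasMax j) (map (suc m ∷_) P ++ P)                      ≡⟨ filter-++ (hasMax j) (map (suc m ∷_) P) P ⟩
  filter (hasMax j) (map (suc m ∷_) P) ++ filter (hasMax j) P  ≡⟨ cong (_++ filter (hasMax j) P) (filter-hasMax-∷-none (s≤s (≤′⇒≤ j≤m)) P) ⟩
  filter (hasMax j) P                                            ≡⟨ filter-hasMax-powerset-elems j≤m ⟩
  subsetsWithMax j                                               ∎
  where
  open ≡-Reasoning
  P = powerset (elems m)

subsetsWithMax-suc : ∀ j → subsetsWithMax (suc j) ≡ map (suc j ∷_) (powerset (elems j))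
subsetsWithMax-suc j = begin
  filter (hasMax (suc j)) (map (suc j ∷_) P ++ P)                            ≡⟨ filter-++ (hasMax (suc j)) (map (suc j ∷_) P) P ⟩
  filter (hasMax (suc j)) (map (suc j ∷_) P) ++ filter (hasMax (suc j)) P  ≡⟨ cong₂ _++_ all-kept none-kept ⟩
  map (suc j ∷_) P ++ []                                                     ≡⟨ ++-identityʳ _ ⟩
  map (suc j ∷_) P                                                           ∎
  where
  open ≡-Reasoning
  P = powerset (elems j)
  all-kept : filter (hasMax (suc j)) (map (suc j ∷_) P) ≡ map (suc j ∷_) P
  all-kept = filter-all (hasMax (suc j))
    (All.map⁺ (All.map (λ ys≤j → m≥n⇒m⊔n≡m (≤-trans ys≤j (n≤1+n j))) (maxS-powerset-elems j)))
  none-kept : filter (hasMax (suc j)) P ≡ []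
  none-kept = filter-none (hasMax (suc j)) (All.map (λ ys≤j max≡ → <⇒≱ (s≤s ys≤j) (≤-reflexive (sym max≡))) (maxS-powerset-elems j))

length-subsetsWithMax : ∀ j → length (subsetsWithMax j) ≡ 2 ^ (j ∸ 1)
length-subsetsWithMax zero    = refl
length-subsetsWithMax (suc j) = begin
  length (subsetsWithMax (suc j))              ≡⟨ cong length (subsetsWithMax-suc j) ⟩
  length (map (suc j ∷_) (powerset (elems j))) ≡⟨ length-map (suc j ∷_) (powerset (elems j)) ⟩
  length (powerset (elems j))                  ≡⟨ length-powerset (elems j) ⟩
  2 ^ length (elems j)                         ≡⟨ cong (2 ^_) (trans (length-map suc (downFrom j)) (length-downFrom j)) ⟩
  2 ^ j                                        ∎
  where open ≡-Reasoning

module _ {c ℓ : Level} (R : CommutativeRing c ℓ) where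

  blockIdx≡sort-subsetsWithMax : ∀ {n k} → k ≤ n → blockIdx R n k ≡ sort (subsetsWithMax (k ∸ 1))
  blockIdx≡sort-subsetsWithMax {n} {k} k≤n = trans
    (filter-sort-lexOrder (hasMax (k ∸ 1)) (powerset (elems (n ∸ 1))))
    (cong sort (filter-hasMax-powerset-elems (≤⇒≤′ (∸-monoˡ-≤ 1 k≤n))))

  length-blockIdx : ∀ {n k} → k ≤ n → length (blockIdx R n k) ≡ 2 ^ (k ∸ 2)
  length-blockIdx {n} {k} k≤n = begin
    length (blockIdx R n k)                    ≡⟨ cong length (blockIdx≡sort-subsetsWithMax k≤n) ⟩
    length (sort (subsetsWithMax (k ∸ 1)))     ≡⟨ ↭-length (sort-↭ (subsetsWithMax (k ∸ 1))) ⟩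
    length (subsetsWithMax (k ∸ 1))            ≡⟨ length-subsetsWithMax (k ∸ 1) ⟩
    2 ^ (k ∸ 1 ∸ 1)                            ≡⟨ cong (2 ^_) (∸-+-assoc k 1 1) ⟩
    2 ^ (k ∸ 2)                                ∎
    where open ≡-Reasoning

lemma4p8 : ∀ {c ℓ : Level} (R : CommutativeRing c ℓ) (q : CommutativeRing.Carrier R) (n : ℕ) → 1 ≤ n →
    ((i j : Fin (length (subsetsOf n))) →
        maxS (lookup (subsetsOf n) i) < maxS (lookup (subsetsOf n) j) →
        CommutativeRing._≈_ R (B R q n i j) (CommutativeRing.0# R))
    × ((k : ℕ) → 1 ≤ k → k ≤ n →
        ((m : ℕ) → k ≤ m → blockA R q m k ≡ blockA R q n k)
        × length (blockIdx R n k) ≡ 2 ^ (k ∸ 2))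
lemma4p8 R q n _ =
  (λ i j → entry-vanishes R q (lookup (subsetsOf n) i) (lookup (subsetsOf n) j)) ,
  λ k _ k≤n → diagonal-block-stable k≤n , length-blockIdx R k≤n
  where

  diagonal-block-stable : ∀ {k} → k ≤ n → (m : ℕ) → k ≤ m → blockA R q m k ≡ blockA R q n k
  diagonal-block-stable k≤n m k≤m = cong (λ L → map (λ I → map (entry R q I) L) L)
    (trans (blockIdx≡sort-subsetsWithMax R k≤m) (sym (blockIdx≡sort-subsetsWithMax R k≤n)))
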